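{- Let $F=\mathbb{F}_q$ with $q$ odd, and let $\rho$ be a nontrivial automorphism of $F$ such that $-1\notin\{x^{\rho-1}\mid x\in F^*\}$. Let $\Sigma$ be the set of $\mathbb{F}_p$-subspaces of $F\oplus F$ consisting of $\{(0,y)\mid y\in F\}$ and $W_m=\{(x,\,m x^{\rho^{ -1}}+m^{\rho}x^{\rho})\mid x\in F\}$ for $m\in F$. For $s\in F^*$ let $\sigma_s(v,w)=(sv,s^{ -1}w)$ and $G=\{\sigma_s\mid s\in F^*\}$. Then under the action of $G$, $\Sigma$ has exactly the following four orbits: $\{\{(x,0)\mid x\in F\}\}$ (i.e. $\{W_0\}$); $\{\{(0,y)\mid y\in F\}\}$; $\{W_m\mid m\in F^*\text{ a nonsquare}\}$; and $\{W_m\mid m\in F^*\text{ a square}\}$.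
   Context: Here $x^{\rho}$ denotes the image of $x$ under $\rho$, $x^{\rho^{ -1}}$ its image under $\rho^{ -1}$, and $x^{\rho-1}=x^{\rho}/x$. -}

module Defs where

open import Level using (0ℓ)
open import Data.Nat using (ℕ)
open import Data.Nat.Divisibility using (_∣_)
open import Data.Fin using (Fin)
open import Data.Product using (Σ; ∃; _×_; _,_)
open import Relation.Nullary using (¬_)
open import Relation.Binary.PropositionalEquality using (_≡_; _≢_)
open import Function.Bundles using (_↔_; _⇔_)
import Algebra.Structures as AS

record FiniteField : Set₁ where
  infixl 7 _*_
  infixl 6 _+_
  infix  8 -_
  infix  9 _⁻¹
  field
    Carrier : Set
    _+_ _*_ : Carrier → Carrier → Carrier
    -_      : Carrier → Carrier
    0# 1#   : Carrier
    isCommutativeRing : AS.IsCommutativeRing {A = Carrier} _≡_ _+_ _*_ -_ 0# 1#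
    _⁻¹     : Carrier → Carrier
    ⁻¹-inverse : ∀ x → x ≢ 0# → x * (x ⁻¹) ≡ 1#
    0≢1     : 0# ≢ 1#
    q       : ℕ
    enum    : Carrier ↔ Fin q

module _ (F : FiniteField) where
  open FiniteField F

  record Automorphism : Set where
    field
      ρ ρ⁻¹    : Carrier → Carrier
      ρ-ρ⁻¹    : ∀ x → ρ (ρ⁻¹ x) ≡ x
      ρ⁻¹-ρ    : ∀ x → ρ⁻¹ (ρ x) ≡ x
      ρ-+      : ∀ x y → ρ (x + y) ≡ ρ x + ρ y
      ρ-*      : ∀ x y → ρ (x * y) ≡ ρ x * ρ y
      ρ-1      : ρ 1# ≡ 1#

  IsSquare : Carrier → Set
  IsSquare m = ∃ λ y → m ≡ y * y

  Subset : Set₁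
  Subset = Carrier × Carrier → Set

  σ-image : Carrier → Subset → Subset
  σ-image s U (v , w) = ∃ λ a → ∃ λ b → U (a , b) × v ≡ s * a × w ≡ s ⁻¹ * b

  _≐_ : Subset → Subset → Set
  U ≐ V = ∀ p → U p ⇔ V p

  data Idx : Set where
    vert : Idx
    W    : Carrier → Idx

  module _ (A : Automorphism) where
    open Automorphism A

    ⟦_⟧ : Idx → Subset
    ⟦ vert ⟧ (v , w) = v ≡ 0#
    ⟦ W m ⟧ (v , w) = ∃ λ x → v ≡ x × w ≡ m * ρ⁻¹ x + ρ m * ρ x

    _∼_ : Idx → Idx → Set
    i ∼ j = ∃ λ s → s ≢ 0# × σ-image s ⟦ i ⟧ ≐ ⟦ j ⟧

    IsOrbit : (Idx → Set) → Set
    IsOrbit S = ∃ λ i → ∀ j → S j ⇔ (i ∼ j)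

  data Kind : Set where
    zeroK vertK nonsquareK squareK : Kind

  Class : Kind → Idx → Set
  Class zeroK      i = i ≡ W 0#
  Class vertK      i = i ≡ vert
  Class nonsquareK i = ∃ λ m → i ≡ W m × m ≢ 0# × ¬ IsSquare m
  Class squareK    i = ∃ λ m → i ≡ W m × m ≢ 0# × IsSquare m

module Submission where

-- σ_s fixes the vertical line and maps W_m onto W_(m ψ(s⁻¹)), where ψ(s) = s s^(ρ⁻¹), so the
-- orbits of the W_m with m ≠ 0 are the cosets of ψ(F*) in F*. Since x^(ρ-1) ≠ -1, the kernel
-- of ψ on F* is {±1}, exactly as for squaring. A multiplicative map with kernel {±1} has an
-- image of index two in F*, which therefore contains all squares; two such images, one inside
-- the other, coincide. Hence ψ(F*) is the group of nonzero squares, giving two orbits.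

open import Defs
open import Data.Nat.Divisibility using (_∣_)
open import Data.Empty using (⊥-elim)
open import Data.Nat using (suc)
open import Data.Fin as Fin using (Fin; punchOut)
import Data.Fin.Properties as Finₚ
import Data.Nat.Properties as ℕₚ
open import Data.Maybe using (nothing)
open import Data.Product using (∃; _×_; _,_; proj₁; proj₂)
open import Data.Sum using (_⊎_; inj₁; inj₂; [_,_]′)
open import Function.Base using (id)
open import Function.Bundles using (Inverse; Injection; Equivalence; _⇔_; mk⇔)
import Function.Properties.Equivalence as ⇔
open import Function.Properties.Inverse using (↔⇒↣; ↔-sym)
open import Algebra.Bundles using (CommutativeRing)
open import Relation.Nullary using (¬_; Dec; yes; no)
open import Relation.Nullary.Decidable using (map′; ¬?; decidable-stable)
open import Relation.Binary.PropositionalEquality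
  using (_≡_; _≢_; refl; sym; trans; cong; cong₂; subst; module ≡-Reasoning)
open import Tactic.RingSolver using (solve-∀)
open import Tactic.RingSolver.Core.AlmostCommutativeRing using (AlmostCommutativeRing; fromCommutativeRing)

Fin-injective⇒surjective : ∀ {n} (f : Fin n → Fin n) → (∀ {a b} → f a ≡ f b → a ≡ b) →
                           ∀ j → ∃ λ i → f i ≡ j
Fin-injective⇒surjective {suc n} f f-inj j with Finₚ.any? (λ i → f i Finₚ.≟ j)
... | yes hit = hit
... | no miss = ⊥-elim (ℕₚ.<-irrefl refl (Finₚ.injective⇒≤ punched-injective))
  where
  f≢j : ∀ i → f i ≢ j
  f≢j i e = miss (i , e)
  punched : Fin (suc n) → Fin n
  punched i = punchOut {i = j} (λ e → f≢j i (sym e))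
  punched-injective : ∀ {a b} → punched a ≡ punched b → a ≡ b
  punched-injective {a} {b} e =
    f-inj (Finₚ.punchOut-injective {i = j} (λ e → f≢j a (sym e)) (λ e → f≢j b (sym e)) e)

module FieldProperties (F : FiniteField) where
  open FiniteField F

  commutativeRing : CommutativeRing _ _
  commutativeRing = record { isCommutativeRing = isCommutativeRing }

  open CommutativeRing commutativeRing public
    using (+-comm; *-comm; *-assoc; *-identityˡ; *-identityʳ; +-identityˡ; +-identityʳ;
           -‿inverseˡ; -‿inverseʳ; zeroˡ; zeroʳ; distribˡ; distribʳ; ring;
           *-commutativeSemigroup; +-commutativeSemigroup)
  open import Algebra.Properties.Ring ring public
    using (-1*x≈-x; -‿distribˡ-*; -‿involutive; -‿anti-homo-+; -0#≈0#; +-inverseʳ-unique;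
           x∙y⁻¹≈ε⇒x≈y; x+x≈x⇒x≈0)
  open import Algebra.Properties.CommutativeSemigroup *-commutativeSemigroup public
    using (xy∙z≈y∙xz) renaming (interchange to *-interchange)
  open import Algebra.Properties.CommutativeSemigroup +-commutativeSemigroup public
    using () renaming (interchange to +-interchange)
  open ≡-Reasoning
  private
    module enum = Inverse enum

    to-injective : ∀ {a b} → enum.to a ≡ enum.to b → a ≡ b
    to-injective = Injection.injective (↔⇒↣ enum)
    almostCommutativeRing : AlmostCommutativeRing _ _
    almostCommutativeRing = fromCommutativeRing commutativeRing (λ _ → nothing)

    module RingIdentities where
      open AlmostCommutativeRing almostCommutativeRing using (_≈_)
        renaming (_+_ to _⊕_; _*_ to _⊛_)

      [x+a][x+b] : ∀ x a b → (x ⊕ a) ⊛ (x ⊕ b) ≈ (x ⊛ x ⊕ a ⊛ b) ⊕ (a ⊕ b) ⊛ x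
      [x+a][x+b] = solve-∀ almostCommutativeRing

  infix 4 _≟_
  _≟_ : (x y : Carrier) → Dec (x ≡ y)
  _≟_ = Finₚ.inj⇒≟ (↔⇒↣ enum)

  ∃? : {P : Carrier → Set} → (∀ x → Dec (P x)) → Dec (∃ P)
  ∃? {P} P? = map′ (λ (i , p) → enum.from i , p)
                   (λ (x , p) → enum.to x , subst P (sym (enum.strictlyInverseʳ x)) p)
                   (Finₚ.any? (λ i → P? (enum.from i)))

  ¬∀⇒∃¬ : {P : Carrier → Set} → (∀ x → Dec (P x)) → ¬ (∀ x → P x) → ∃ λ x → ¬ P x
  ¬∀⇒∃¬ P? ¬all with ∃? (λ x → ¬? (P? x))
  ... | yes counterexample = counterexample
  ... | no none = ⊥-elim (¬all λ x → decidable-stable (P? x) (λ ¬p → none (x , ¬p)))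

  injective⇒surjective : (f : Carrier → Carrier) → (∀ {a b} → f a ≡ f b → a ≡ b) →
                         ∀ y → ∃ λ x → f x ≡ y
  injective⇒surjective f f-inj y = enum.from i , f[from-i]≡y
    where
    from-inj = Injection.injective (↔⇒↣ (↔-sym enum))
    g : Fin q → Fin q
    g i = enum.to (f (enum.from i))
    hit = Fin-injective⇒surjective g (λ e → from-inj (f-inj (to-injective e))) (enum.to y)
    i = proj₁ hit
    f[from-i]≡y : f (enum.from i) ≡ y
    f[from-i]≡y = to-injective (proj₂ hit)

  surjective⇒injective : (f : Carrier → Carrier) → (∀ y → ∃ λ x → f x ≡ y) →
                         ∀ {a b} → f a ≡ f b → a ≡ b
  surjective⇒injective f f-surj {a} {b} fa≡fb = begin
    a   ≡⟨ sym ga≡a ⟩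
    g c ≡⟨ cong g c≡d ⟩
    g d ≡⟨ gd≡b ⟩
    b   ∎
    where
    g : Carrier → Carrier
    g y = proj₁ (f-surj y)
    f∘g : ∀ y → f (g y) ≡ y
    f∘g y = proj₂ (f-surj y)
    g-surj = injective⇒surjective g (λ {c} {d} e → trans (sym (f∘g c)) (trans (cong f e) (f∘g d)))
    c = proj₁ (g-surj a)
    d = proj₁ (g-surj b)
    ga≡a = proj₂ (g-surj a)
    gd≡b = proj₂ (g-surj b)
    c≡d : c ≡ d
    c≡d = begin
      c       ≡⟨ sym (f∘g c) ⟩
      f (g c) ≡⟨ cong f ga≡a ⟩
      f a     ≡⟨ fa≡fb ⟩
      f b     ≡⟨ cong f (sym gd≡b) ⟩
      f (g d) ≡⟨ f∘g d ⟩
      d       ∎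

  1≢0 : 1# ≢ 0#
  1≢0 e = 0≢1 (sym e)

  ⁻¹-inverseˡ : ∀ {x} → x ≢ 0# → x ⁻¹ * x ≡ 1#
  ⁻¹-inverseˡ {x} x≢0 = trans (*-comm (x ⁻¹) x) (⁻¹-inverse x x≢0)

  x⁻¹*[x*y]≡y : ∀ {x} y → x ≢ 0# → x ⁻¹ * (x * y) ≡ y
  x⁻¹*[x*y]≡y {x} y x≢0 =
    trans (sym (*-assoc (x ⁻¹) x y)) (trans (cong (_* y) (⁻¹-inverseˡ x≢0)) (*-identityˡ y))

  x*[x⁻¹*y]≡y : ∀ {x} y → x ≢ 0# → x * (x ⁻¹ * y) ≡ y
  x*[x⁻¹*y]≡y {x} y x≢0 =
    trans (sym (*-assoc x (x ⁻¹) y)) (trans (cong (_* y) (⁻¹-inverse x x≢0)) (*-identityˡ y))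

  *-cancelˡ : ∀ {a x y} → a ≢ 0# → a * x ≡ a * y → x ≡ y
  *-cancelˡ {a} {x} {y} a≢0 e = begin
    x              ≡⟨ sym (x⁻¹*[x*y]≡y x a≢0) ⟩
    a ⁻¹ * (a * x) ≡⟨ cong (a ⁻¹ *_) e ⟩
    a ⁻¹ * (a * y) ≡⟨ x⁻¹*[x*y]≡y y a≢0 ⟩
    y              ∎

  x*y≡0⇒x≡0⊎y≡0 : ∀ {x y} → x * y ≡ 0# → x ≡ 0# ⊎ y ≡ 0#
  x*y≡0⇒x≡0⊎y≡0 {x} {y} e with x ≟ 0#
  ... | yes x≡0 = inj₁ x≡0
  ... | no x≢0 = inj₂ (*-cancelˡ x≢0 (trans e (sym (zeroʳ x))))

  *-≢0 : ∀ {x y} → x ≢ 0# → y ≢ 0# → x * y ≢ 0#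
  *-≢0 x≢0 y≢0 e with x*y≡0⇒x≡0⊎y≡0 e
  ... | inj₁ x≡0 = x≢0 x≡0
  ... | inj₂ y≡0 = y≢0 y≡0

  x*y≡1⇒x≢0 : ∀ {x y} → x * y ≡ 1# → x ≢ 0#
  x*y≡1⇒x≢0 {x} {y} e x≡0 = 1≢0 (trans (sym e) (trans (cong (_* y) x≡0) (zeroˡ y)))

  ⁻¹-unique : ∀ {x y} → x * y ≡ 1# → y ≡ x ⁻¹
  ⁻¹-unique {x} {y} e = *-cancelˡ (x*y≡1⇒x≢0 e) (trans e (sym (⁻¹-inverse x (x*y≡1⇒x≢0 e))))

  ⁻¹-≢0 : ∀ {x} → x ≢ 0# → x ⁻¹ ≢ 0#
  ⁻¹-≢0 {x} x≢0 = x*y≡1⇒x≢0 (⁻¹-inverseˡ x≢0)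

  ⁻¹-involutive : ∀ {x} → x ≢ 0# → x ⁻¹ ⁻¹ ≡ x
  ⁻¹-involutive x≢0 = sym (⁻¹-unique (⁻¹-inverseˡ x≢0))

  x*y*y⁻¹≡x : ∀ x {y} → y ≢ 0# → x * y * y ⁻¹ ≡ x
  x*y*y⁻¹≡x x {y} y≢0 =
    trans (*-assoc x y (y ⁻¹)) (trans (cong (x *_) (⁻¹-inverse y y≢0)) (*-identityʳ x))

  x*y⁻¹*y≡x : ∀ x {y} → y ≢ 0# → x * y ⁻¹ * y ≡ x
  x*y⁻¹*y≡x x {y} y≢0 =
    trans (*-assoc x (y ⁻¹) y) (trans (cong (x *_) (⁻¹-inverseˡ y≢0)) (*-identityʳ x))

  x*x≡1⇒x≡±1 : ∀ {x} → x * x ≡ 1# → x ≡ 1# ⊎ x ≡ - 1#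
  x*x≡1⇒x≡±1 {x} x²≡1 with x*y≡0⇒x≡0⊎y≡0 [x-1][x+1]≡0
    where
    [x-1][x+1]≡0 : (x + - 1#) * (x + 1#) ≡ 0#
    [x-1][x+1]≡0 = begin
      (x + - 1#) * (x + 1#)                    ≡⟨ RingIdentities.[x+a][x+b] x (- 1#) 1# ⟩
      (x * x + - 1# * 1#) + (- 1# + 1#) * x    ≡⟨ cong₂ _+_ (cong₂ _+_ x²≡1 (*-identityʳ (- 1#)))
                                                            (cong (_* x) (-‿inverseˡ 1#)) ⟩
      (1# + - 1#) + 0# * x                     ≡⟨ cong₂ _+_ (-‿inverseʳ 1#) (zeroˡ x) ⟩
      0# + 0#                                  ≡⟨ +-identityʳ 0# ⟩
      0#                                       ∎
  ... | inj₁ x-1≡0 = inj₁ (x∙y⁻¹≈ε⇒x≈y x 1# x-1≡0)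
  ... | inj₂ x+1≡0 = inj₂ (+-inverseʳ-unique 1# x (trans (+-comm 1# x) x+1≡0))

  multiplicative-⁻¹ : (f : Carrier → Carrier) → (∀ x y → f (x * y) ≡ f x * f y) → f 1# ≡ 1# →
                      ∀ {x} → x ≢ 0# → f (x ⁻¹) ≡ f x ⁻¹
  multiplicative-⁻¹ f f-* f-1 {x} x≢0 =
    ⁻¹-unique (trans (sym (f-* x (x ⁻¹))) (trans (cong f (⁻¹-inverse x x≢0)) f-1))

  additive-0 : (f : Carrier → Carrier) → (∀ x y → f (x + y) ≡ f x + f y) → f 0# ≡ 0#
  additive-0 f f-+ = x+x≈x⇒x≈0 (f 0#) (trans (sym (f-+ 0# 0#)) (cong f (+-identityˡ 0#)))

  additive-neg : (f : Carrier → Carrier) → (∀ x y → f (x + y) ≡ f x + f y) → ∀ x → f (- x) ≡ - f x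
  additive-neg f f-+ x =
    +-inverseʳ-unique (f x) (f (- x)) (trans (sym (f-+ x (- x))) (trans (cong f (-‿inverseʳ x)) (additive-0 f f-+)))

  record TwoToOne : Set where
    field
      φ         : Carrier → Carrier
      φ-*       : ∀ x y → φ (x * y) ≡ φ x * φ y
      φ-0       : φ 0# ≡ 0#
      φ-1       : φ 1# ≡ 1#
      φ-−1      : φ (- 1#) ≡ 1#
      φx≡0⇒x≡0  : ∀ {x} → φ x ≡ 0# → x ≡ 0#
      φx≡1⇒x≡±1 : ∀ {x} → φ x ≡ 1# → x ≡ 1# ⊎ x ≡ - 1#

  module _ (1≢-1 : 1# ≢ - 1#) where

    x≡-x⇒x≡0 : ∀ {x} → x ≡ - x → x ≡ 0#
    x≡-x⇒x≡0 {x} x≡-x with x*y≡0⇒x≡0⊎y≡0 [1+1]x≡0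
      where
      [1+1]x≡0 : (1# + 1#) * x ≡ 0#
      [1+1]x≡0 = begin
        (1# + 1#) * x    ≡⟨ distribʳ x 1# 1# ⟩
        1# * x + 1# * x  ≡⟨ cong₂ _+_ (*-identityˡ x) (*-identityˡ x) ⟩
        x + x            ≡⟨ cong (x +_) x≡-x ⟩
        x + - x          ≡⟨ -‿inverseʳ x ⟩
        0#               ∎
    ... | inj₁ 1+1≡0 = ⊥-elim (1≢-1 (+-inverseʳ-unique 1# 1# 1+1≡0))
    ... | inj₂ x≡0 = x≡0

    Canonical : Carrier → Set
    Canonical x = enum.to x Fin.≤ enum.to (- x)

    canonical? : ∀ x → Dec (Canonical x)
    canonical? x = enum.to x Finₚ.≤? enum.to (- x)

    canonical-0 : Canonical 0#
    canonical-0 = Finₚ.≤-reflexive (cong enum.to (sym -0#≈0#))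

    ¬canonical⇒canonical-neg : ∀ {x} → ¬ Canonical x → Canonical (- x)
    ¬canonical⇒canonical-neg {x} ¬c =
      subst (λ t → enum.to (- x) Fin.≤ enum.to t) (sym (-‿involutive x)) (ℕₚ.<⇒≤ (ℕₚ.≰⇒> ¬c))

    canonical-both⇒0 : ∀ {x} → Canonical x → Canonical (- x) → x ≡ 0#
    canonical-both⇒0 {x} c c-neg = x≡-x⇒x≡0 (to-injective (Finₚ.≤-antisym c c-neg′))
      where
      c-neg′ : enum.to (- x) Fin.≤ enum.to x
      c-neg′ = subst (λ t → enum.to (- x) Fin.≤ enum.to t) (-‿involutive x) c-neg

    module TwoToOneProperties (h : TwoToOne) where
      open TwoToOne h

      Image : Carrier → Set
      Image z = ∃ λ x → φ x ≡ z

      image? : ∀ z → Dec (Image z)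
      image? z = ∃? (λ x → φ x ≟ z)

      image-* : ∀ {a b} → Image a → Image b → Image (a * b)
      image-* (x , φx≡a) (y , φy≡b) = x * y , trans (φ-* x y) (cong₂ _*_ φx≡a φy≡b)

      image-⁻¹ : ∀ {a} → a ≢ 0# → Image a → Image (a ⁻¹)
      image-⁻¹ a≢0 (x , φx≡a) = x ⁻¹ , trans (multiplicative-⁻¹ φ φ-* φ-1 x≢0) (cong _⁻¹ φx≡a)
        where
        x≢0 : x ≢ 0#
        x≢0 x≡0 = a≢0 (trans (sym φx≡a) (trans (cong φ x≡0) φ-0))

      image-cancelʳ : ∀ {a b} → b ≢ 0# → Image (a * b) → Image b → Image a
      image-cancelʳ {a} {b} b≢0 ab∈ b∈ =
        subst Image (x*y*y⁻¹≡x a b≢0) (image-* ab∈ (image-⁻¹ b≢0 b∈))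

      fibre : ∀ {x y} → φ x ≡ φ y → y ≡ x ⊎ y ≡ - x
      fibre {x} {y} φx≡φy with x ≟ 0#
      ... | yes x≡0 =
        inj₁ (trans (φx≡0⇒x≡0 (trans (sym φx≡φy) (trans (cong φ x≡0) φ-0))) (sym x≡0))
      ... | no x≢0 with φx≡1⇒x≡±1 φ[yx⁻¹]≡1
        where
        φ[yx⁻¹]≡1 : φ (y * x ⁻¹) ≡ 1#
        φ[yx⁻¹]≡1 = begin
          φ (y * x ⁻¹)       ≡⟨ φ-* y (x ⁻¹) ⟩
          φ y * φ (x ⁻¹)     ≡⟨ cong (_* φ (x ⁻¹)) (sym φx≡φy) ⟩
          φ x * φ (x ⁻¹)     ≡⟨ sym (φ-* x (x ⁻¹)) ⟩
          φ (x * x ⁻¹)       ≡⟨ cong φ (⁻¹-inverse x x≢0) ⟩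
          φ 1#               ≡⟨ φ-1 ⟩
          1#                 ∎
      ... | inj₁ yx⁻¹≡1  = inj₁ (trans (sym (x*y⁻¹*y≡x y x≢0))
                                       (trans (cong (_* x) yx⁻¹≡1) (*-identityˡ x)))
      ... | inj₂ yx⁻¹≡-1 = inj₂ (trans (sym (x*y⁻¹*y≡x y x≢0))
                                       (trans (cong (_* x) yx⁻¹≡-1) (-1*x≈-x x)))

      private
        nonImage : ∃ λ z → ¬ Image z
        nonImage = ¬∀⇒∃¬ image? λ surjective →
          1≢-1 (surjective⇒injective φ surjective (trans φ-1 (sym φ-−1)))

      ν : Carrier
      ν = proj₁ nonImage

      ν∉Image : ¬ Image ν
      ν∉Image = proj₂ nonImage

      ν≢0 : ν ≢ 0#
      ν≢0 ν≡0 = ν∉Image (0# , trans φ-0 (sym ν≡0))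

      private
        ν∉Image-* : ∀ {x y} → y ≢ 0# → φ x ≢ ν * φ y
        ν∉Image-* {x} {y} y≢0 e =
          ν∉Image (image-cancelʳ (λ φy≡0 → y≢0 (φx≡0⇒x≡0 φy≡0)) (x , e) (y , refl))

        -- select is injective, hence onto, which is the index-two property of the image.
        select : ∀ x → Dec (Canonical x) → Carrier
        select x (yes _) = φ x
        select x (no _)  = ν * φ x

        ¬canonical⇒≢0 : ∀ {y} → ¬ Canonical y → y ≢ 0#
        ¬canonical⇒≢0 ¬c y≡0 = ¬c (subst Canonical (sym y≡0) canonical-0)

        select-injective : ∀ x y (cx : Dec (Canonical x)) (cy : Dec (Canonical y)) →
                           select x cx ≡ select y cy → x ≡ y
        select-injective x y (yes cx) (yes cy) e with fibre e
        ... | inj₁ y≡x = sym y≡x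
        ... | inj₂ y≡-x = trans x≡0 (sym (trans y≡-x (trans (cong -_ x≡0) -0#≈0#)))
          where
          x≡0 = canonical-both⇒0 cx (subst Canonical y≡-x cy)
        select-injective x y (no cx) (no cy) e with fibre (*-cancelˡ ν≢0 e)
        ... | inj₁ y≡x = sym y≡x
        ... | inj₂ y≡-x = ⊥-elim (cy (subst Canonical (sym y≡-x) (¬canonical⇒canonical-neg cx)))
        select-injective x y (yes _) (no cy) e = ⊥-elim (ν∉Image-* (¬canonical⇒≢0 cy) e)
        select-injective x y (no cx) (yes _) e = ⊥-elim (ν∉Image-* (¬canonical⇒≢0 cx) (sym e))

      image-or-coset : ∀ z → Image z ⊎ ∃ λ x → ν * φ x ≡ z
      image-or-coset z = split (proj₁ hit) (canonical? (proj₁ hit)) (proj₂ hit)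
        where
        hit = injective⇒surjective (λ x → select x (canonical? x))
                (λ {a} {b} → select-injective a b (canonical? a) (canonical? b)) z
        split : ∀ x (c : Dec (Canonical x)) → select x c ≡ z → Image z ⊎ ∃ λ x → ν * φ x ≡ z
        split x (yes _) e = inj₁ (x , e)
        split x (no _)  e = inj₂ (x , e)

      square∈Image : ∀ y → Image (y * y)
      square∈Image y with image-or-coset y
      ... | inj₁ y∈ = image-* y∈ y∈
      ... | inj₂ (x , νφx≡y) =
        subst Image (trans (*-interchange ν ν (φ x) (φ x)) (cong₂ _*_ νφx≡y νφx≡y))
                    (image-* ν²∈Image (image-* (x , refl) (x , refl)))
        where
        ν²∈Image : Image (ν * ν)
        ν²∈Image with image-or-coset (ν * ν)
        ... | inj₁ ν²∈ = ν²∈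
        ... | inj₂ (b , νφb≡νν) = ⊥-elim (ν∉Image (b , *-cancelˡ ν≢0 νφb≡νν))

    module _ (h k : TwoToOne) where
      private
        module H = TwoToOneProperties h
        module K = TwoToOneProperties k
        open TwoToOne k

      image-⊆⇒⊇ : (∀ {z} → K.Image z → H.Image z) → ∀ {z} → H.Image z → K.Image z
      image-⊆⇒⊇ k⊆h {z} z∈h with K.image-or-coset z
      ... | inj₁ z∈k = z∈k
      ... | inj₂ (y , νφy≡z) with y ≟ 0#
      ...   | yes y≡0 = y , (begin
              φ y        ≡⟨ φy≡0 ⟩
              0#         ≡⟨ sym (zeroʳ K.ν) ⟩
              K.ν * 0#   ≡⟨ cong (K.ν *_) (sym φy≡0) ⟩
              K.ν * φ y  ≡⟨ νφy≡z ⟩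
              z          ∎)
        where
        φy≡0 : φ y ≡ 0#
        φy≡0 = trans (cong φ y≡0) φ-0
      ...   | no y≢0 = ⊥-elim (H.ν∉Image (all∈H H.ν))
        where
        νₖ∈H : H.Image K.ν
        νₖ∈H = H.image-cancelʳ (λ φy≡0 → y≢0 (φx≡0⇒x≡0 φy≡0))
                 (subst H.Image (sym νφy≡z) z∈h) (k⊆h (y , refl))
        all∈H : ∀ w → H.Image w
        all∈H w with K.image-or-coset w
        ... | inj₁ w∈k = k⊆h w∈k
        ... | inj₂ (x , νφx≡w) = subst H.Image νφx≡w (H.image-* νₖ∈H (k⊆h (x , refl)))

  squaring : TwoToOne
  squaring = record
    { φ         = λ x → x * x
    ; φ-*       = λ x y → *-interchange x y x y
    ; φ-0       = zeroˡ 0#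
    ; φ-1       = *-identityˡ 1#
    ; φ-−1      = trans (-1*x≈-x (- 1#)) (-‿involutive 1#)
    ; φx≡0⇒x≡0  = λ x²≡0 → [ id , id ]′ (x*y≡0⇒x≡0⊎y≡0 x²≡0)
    ; φx≡1⇒x≡±1 = x*x≡1⇒x≡±1
    }

module Orbits (F : FiniteField) (A : Automorphism F) where
  open FiniteField F
  open FieldProperties F
  open Automorphism A
  open ≡-Reasoning

  ρ-injective : ∀ {x y} → ρ x ≡ ρ y → x ≡ y
  ρ-injective {x} {y} e = trans (sym (ρ⁻¹-ρ x)) (trans (cong ρ⁻¹ e) (ρ⁻¹-ρ y))

  ρ⁻¹-homomorphic : (_∙_ : Carrier → Carrier → Carrier) → (∀ x y → ρ (x ∙ y) ≡ ρ x ∙ ρ y) →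
                    ∀ x y → ρ⁻¹ (x ∙ y) ≡ ρ⁻¹ x ∙ ρ⁻¹ y
  ρ⁻¹-homomorphic _∙_ ρ-∙ x y = ρ-injective (begin
    ρ (ρ⁻¹ (x ∙ y))         ≡⟨ ρ-ρ⁻¹ (x ∙ y) ⟩
    x ∙ y                   ≡⟨ sym (cong₂ _∙_ (ρ-ρ⁻¹ x) (ρ-ρ⁻¹ y)) ⟩
    ρ (ρ⁻¹ x) ∙ ρ (ρ⁻¹ y)   ≡⟨ sym (ρ-∙ (ρ⁻¹ x) (ρ⁻¹ y)) ⟩
    ρ (ρ⁻¹ x ∙ ρ⁻¹ y)       ∎)

  ρ⁻¹-+ : ∀ x y → ρ⁻¹ (x + y) ≡ ρ⁻¹ x + ρ⁻¹ y
  ρ⁻¹-+ = ρ⁻¹-homomorphic _+_ ρ-+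

  ρ⁻¹-* : ∀ x y → ρ⁻¹ (x * y) ≡ ρ⁻¹ x * ρ⁻¹ y
  ρ⁻¹-* = ρ⁻¹-homomorphic _*_ ρ-*

  ρ⁻¹-1 : ρ⁻¹ 1# ≡ 1#
  ρ⁻¹-1 = ρ-injective (trans (ρ-ρ⁻¹ 1#) (sym ρ-1))

  ψ : Carrier → Carrier
  ψ x = x * ρ⁻¹ x

  ψ-* : ∀ x y → ψ (x * y) ≡ ψ x * ψ y
  ψ-* x y = trans (cong ((x * y) *_) (ρ⁻¹-* x y)) (*-interchange x y (ρ⁻¹ x) (ρ⁻¹ y))

  ≐-sym : ∀ {U V} → _≐_ F U V → _≐_ F V U
  ≐-sym U≐V p = ⇔.sym (U≐V p)

  ≐-trans : ∀ {U V X} → _≐_ F U V → _≐_ F V X → _≐_ F U X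
  ≐-trans U≐V V≐X p = ⇔.trans (U≐V p) (V≐X p)

  ⟪_⟫ : Idx F → Subset F
  ⟪_⟫ = ⟦_⟧ F A

  W-snd : Carrier → Carrier → Carrier
  W-snd m x = m * ρ⁻¹ x + ρ m * ρ x

  W-snd-scale : ∀ {u s} m x → u * s ≡ 1# → W-snd (m * ψ u) (s * x) ≡ u * W-snd m x
  W-snd-scale {u} {s} m x us≡1 = begin
    m * ψ u * ρ⁻¹ (s * x) + ρ (m * ψ u) * ρ (s * x)
      ≡⟨ cong₂ _+_ (cong (m * ψ u *_) (ρ⁻¹-* s x)) (cong₂ _*_ (ρ-* m (ψ u)) (ρ-* s x)) ⟩
    m * ψ u * (ρ⁻¹ s * ρ⁻¹ x) + ρ m * ρ (ψ u) * (ρ s * ρ x)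
      ≡⟨ cong₂ _+_ (reassociate m (ψ u) (ρ⁻¹ s) (ρ⁻¹ x))
                   (reassociate (ρ m) (ρ (ψ u)) (ρ s) (ρ x)) ⟩
    m * (ψ u * ρ⁻¹ s) * ρ⁻¹ x + ρ m * (ρ (ψ u) * ρ s) * ρ x
      ≡⟨ cong₂ _+_ (cong (λ c → m * c * ρ⁻¹ x) ψu*ρ⁻¹s≡u)
                   (cong (λ c → ρ m * c * ρ x) ρψu*ρs≡u) ⟩
    m * u * ρ⁻¹ x + ρ m * u * ρ x
      ≡⟨ cong₂ _+_ (xy∙z≈y∙xz m u (ρ⁻¹ x)) (xy∙z≈y∙xz (ρ m) u (ρ x)) ⟩
    u * (m * ρ⁻¹ x) + u * (ρ m * ρ x)
      ≡⟨ sym (distribˡ u (m * ρ⁻¹ x) (ρ m * ρ x)) ⟩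
    u * W-snd m x ∎
    where
    reassociate : ∀ a b c d → a * b * (c * d) ≡ a * (b * c) * d
    reassociate a b c d =
      trans (*-assoc a b (c * d)) (trans (cong (a *_) (sym (*-assoc b c d))) (sym (*-assoc a (b * c) d)))
    ρ⁻¹[us]≡1 : ρ⁻¹ (u * s) ≡ 1#
    ρ⁻¹[us]≡1 = trans (cong ρ⁻¹ us≡1) ρ⁻¹-1
    ψu*ρ⁻¹s≡u : ψ u * ρ⁻¹ s ≡ u
    ψu*ρ⁻¹s≡u = begin
      u * ρ⁻¹ u * ρ⁻¹ s     ≡⟨ *-assoc u (ρ⁻¹ u) (ρ⁻¹ s) ⟩
      u * (ρ⁻¹ u * ρ⁻¹ s)   ≡⟨ cong (u *_) (trans (sym (ρ⁻¹-* u s)) ρ⁻¹[us]≡1) ⟩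
      u * 1#                ≡⟨ *-identityʳ u ⟩
      u                     ∎
    ρψu*ρs≡u : ρ (ψ u) * ρ s ≡ u
    ρψu*ρs≡u = begin
      ρ (ψ u) * ρ s           ≡⟨ sym (ρ-* (ψ u) s) ⟩
      ρ (u * ρ⁻¹ u * s)       ≡⟨ cong ρ (xy∙z≈y∙xz u (ρ⁻¹ u) s) ⟩
      ρ (ρ⁻¹ u * (u * s))     ≡⟨ cong (λ c → ρ (ρ⁻¹ u * c)) us≡1 ⟩
      ρ (ρ⁻¹ u * 1#)          ≡⟨ cong ρ (*-identityʳ (ρ⁻¹ u)) ⟩
      ρ (ρ⁻¹ u)               ≡⟨ ρ-ρ⁻¹ u ⟩
      u                       ∎

  σ-image-W : ∀ {s} m → s ≢ 0# → _≐_ F (σ-image F s ⟪ W m ⟫) ⟪ W (m * ψ (s ⁻¹)) ⟫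
  σ-image-W {s} m s≢0 (v , w) = mk⇔ to from
    where
    to : σ-image F s ⟪ W m ⟫ (v , w) → ⟪ W (m * ψ (s ⁻¹)) ⟫ (v , w)
    to (a , b , (x , a≡x , b≡W-snd) , v≡sa , w≡s⁻¹b) =
      s * x , trans v≡sa (cong (s *_) a≡x) ,
      trans w≡s⁻¹b (trans (cong (s ⁻¹ *_) b≡W-snd) (sym (W-snd-scale m x (⁻¹-inverseˡ s≢0))))
    from : ⟪ W (m * ψ (s ⁻¹)) ⟫ (v , w) → σ-image F s ⟪ W m ⟫ (v , w)
    from (x , v≡x , w≡W-snd) =
      s ⁻¹ * x , s * w , (s ⁻¹ * x , refl , s*w≡W-snd) ,
      trans v≡x (sym (x*[x⁻¹*y]≡y x s≢0)) , sym (x⁻¹*[x*y]≡y w s≢0)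
      where
      s*w≡W-snd : s * w ≡ W-snd m (s ⁻¹ * x)
      s*w≡W-snd = begin
        s * w
          ≡⟨ cong (s *_) w≡W-snd ⟩
        s * W-snd (m * ψ (s ⁻¹)) x
          ≡⟨ cong (λ c → s * W-snd (m * ψ (s ⁻¹)) c) (sym (x*[x⁻¹*y]≡y x s≢0)) ⟩
        s * W-snd (m * ψ (s ⁻¹)) (s * (s ⁻¹ * x))
          ≡⟨ cong (s *_) (W-snd-scale m (s ⁻¹ * x) (⁻¹-inverseˡ s≢0)) ⟩
        s * (s ⁻¹ * W-snd m (s ⁻¹ * x))
          ≡⟨ x*[x⁻¹*y]≡y _ s≢0 ⟩
        W-snd m (s ⁻¹ * x) ∎

  σ-image-vert : ∀ {s} → s ≢ 0# → _≐_ F (σ-image F s ⟪ vert ⟫) ⟪ vert ⟫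
  σ-image-vert {s} s≢0 (v , w) = mk⇔
    (λ (a , b , a≡0 , v≡sa , _) → trans v≡sa (trans (cong (s *_) a≡0) (zeroʳ s)))
    (λ v≡0 → 0# , s * w , refl , trans v≡0 (sym (zeroʳ s)) , sym (x⁻¹*[x*y]≡y w s≢0))

  module _ (ρx*x⁻¹≢-1 : ∀ x → x ≢ 0# → ρ x * x ⁻¹ ≢ - 1#) where

    1≢-1 : 1# ≢ - 1#
    1≢-1 1≡-1 = ρx*x⁻¹≢-1 1# 1≢0 (trans (cong (_* 1# ⁻¹) ρ-1) (trans (⁻¹-inverse 1# 1≢0) 1≡-1))

    ρx≡-x⇒x≡0 : ∀ {x} → ρ x ≡ - x → x ≡ 0#
    ρx≡-x⇒x≡0 {x} ρx≡-x with x ≟ 0#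
    ... | yes x≡0 = x≡0
    ... | no x≢0 = ⊥-elim (ρx*x⁻¹≢-1 x x≢0 (begin
      ρ x * x ⁻¹     ≡⟨ cong (_* x ⁻¹) ρx≡-x ⟩
      - x * x ⁻¹     ≡⟨ sym (-‿distribˡ-* x (x ⁻¹)) ⟩
      - (x * x ⁻¹)   ≡⟨ cong -_ (⁻¹-inverse x x≢0) ⟩
      - 1#           ∎))

    ψx≡1⇒x≡±1 : ∀ {s} → ψ s ≡ 1# → s ≡ 1# ⊎ s ≡ - 1#
    ψx≡1⇒x≡±1 {s} ψs≡1 = x*x≡1⇒x≡±1 (trans (cong (s *_) s≡s⁻¹) (⁻¹-inverse s s≢0))
      where
      s≢0 : s ≢ 0#
      s≢0 = x*y≡1⇒x≢0 ψs≡1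
      ρs≡s⁻¹ : ρ s ≡ s ⁻¹
      ρs≡s⁻¹ = ⁻¹-unique (begin
        s * ρ s               ≡⟨ *-comm s (ρ s) ⟩
        ρ s * s               ≡⟨ cong (ρ s *_) (sym (ρ-ρ⁻¹ s)) ⟩
        ρ s * ρ (ρ⁻¹ s)       ≡⟨ sym (ρ-* s (ρ⁻¹ s)) ⟩
        ρ (ψ s)               ≡⟨ cong ρ ψs≡1 ⟩
        ρ 1#                  ≡⟨ ρ-1 ⟩
        1#                    ∎)
      ρs⁻¹≡s : ρ (s ⁻¹) ≡ s
      ρs⁻¹≡s = trans (multiplicative-⁻¹ ρ ρ-* ρ-1 s≢0)
                     (trans (cong _⁻¹ ρs≡s⁻¹) (⁻¹-involutive s≢0))
      t = s + - s ⁻¹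
      ρt≡-t : ρ t ≡ - t
      ρt≡-t = begin
        ρ (s + - s ⁻¹)          ≡⟨ ρ-+ s (- s ⁻¹) ⟩
        ρ s + ρ (- s ⁻¹)        ≡⟨ cong₂ _+_ ρs≡s⁻¹
                                             (trans (additive-neg ρ ρ-+ (s ⁻¹)) (cong -_ ρs⁻¹≡s)) ⟩
        s ⁻¹ + - s              ≡⟨ cong (_+ - s) (sym (-‿involutive (s ⁻¹))) ⟩
        - - s ⁻¹ + - s          ≡⟨ sym (-‿anti-homo-+ s (- s ⁻¹)) ⟩
        - (s + - s ⁻¹)          ∎
      s≡s⁻¹ : s ≡ s ⁻¹
      s≡s⁻¹ = x∙y⁻¹≈ε⇒x≈y s (s ⁻¹) (ρx≡-x⇒x≡0 ρt≡-t)

    ψ-twoToOne : TwoToOne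
    ψ-twoToOne = record
      { φ         = ψ
      ; φ-*       = ψ-*
      ; φ-0       = zeroˡ (ρ⁻¹ 0#)
      ; φ-1       = trans (*-identityˡ (ρ⁻¹ 1#)) ρ⁻¹-1
      ; φ-−1      = trans (cong (- 1# *_) ρ⁻¹[-1]≡-1) (TwoToOne.φ-−1 squaring)
      ; φx≡0⇒x≡0  = ψx≡0⇒x≡0
      ; φx≡1⇒x≡±1 = ψx≡1⇒x≡±1
      }
      where
      ρ⁻¹[-1]≡-1 : ρ⁻¹ (- 1#) ≡ - 1#
      ρ⁻¹[-1]≡-1 = trans (additive-neg ρ⁻¹ ρ⁻¹-+ 1#) (cong -_ ρ⁻¹-1)
      ψx≡0⇒x≡0 : ∀ {x} → ψ x ≡ 0# → x ≡ 0#
      ψx≡0⇒x≡0 {x} ψx≡0 with x*y≡0⇒x≡0⊎y≡0 ψx≡0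
      ... | inj₁ x≡0 = x≡0
      ... | inj₂ ρ⁻¹x≡0 = trans (sym (ρ-ρ⁻¹ x)) (trans (cong ρ ρ⁻¹x≡0) (additive-0 ρ ρ-+))

    private
      module Ψ = TwoToOneProperties 1≢-1 ψ-twoToOne
      module Square = TwoToOneProperties 1≢-1 squaring

    isSquare⇒ψ-image : ∀ {m} → IsSquare F m → ∃ λ s → ψ s ≡ m
    isSquare⇒ψ-image (y , m≡y²) = subst Ψ.Image (sym m≡y²) (Ψ.square∈Image y)

    ψ-isSquare : ∀ s → IsSquare F (ψ s)
    ψ-isSquare s with image-⊆⇒⊇ 1≢-1 ψ-twoToOne squaring square⇒ψ-image (s , refl)
      where
      square⇒ψ-image : ∀ {z} → Square.Image z → Ψ.Image z
      square⇒ψ-image (y , y²≡z) = isSquare⇒ψ-image (y , sym y²≡z)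
    ... | y , y²≡ψs = y , sym y²≡ψs

    m+ρm-injective : ∀ {m k} → m + ρ m ≡ k + ρ k → m ≡ k
    m+ρm-injective {m} {k} e = x∙y⁻¹≈ε⇒x≈y m k (ρx≡-x⇒x≡0 (+-inverseʳ-unique d (ρ d) d+ρd≡0))
      where
      d = m + - k
      d+ρd≡0 : d + ρ d ≡ 0#
      d+ρd≡0 = begin
        (m + - k) + ρ (m + - k)        ≡⟨ cong ((m + - k) +_)
                                                  (trans (ρ-+ m (- k)) (cong (ρ m +_) (additive-neg ρ ρ-+ k))) ⟩
        (m + - k) + (ρ m + - ρ k)      ≡⟨ +-interchange m (- k) (ρ m) (- ρ k) ⟩
        (m + ρ m) + (- k + - ρ k)      ≡⟨ cong (_+ (- k + - ρ k)) e ⟩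
        (k + ρ k) + (- k + - ρ k)      ≡⟨ +-interchange k (ρ k) (- k) (- ρ k) ⟩
        (k + - k) + (ρ k + - ρ k)      ≡⟨ cong₂ _+_ (-‿inverseʳ k) (-‿inverseʳ (ρ k)) ⟩
        0# + 0#                        ≡⟨ +-identityʳ 0# ⟩
        0#                             ∎

    W-snd-1 : ∀ m → W-snd m 1# ≡ m + ρ m
    W-snd-1 m = cong₂ _+_ (trans (cong (m *_) ρ⁻¹-1) (*-identityʳ m))
                          (trans (cong (ρ m *_) ρ-1) (*-identityʳ (ρ m)))

    W-injective : ∀ {m k} → _≐_ F ⟪ W m ⟫ ⟪ W k ⟫ → m ≡ k
    W-injective {m} {k} W≐W with Equivalence.to (W≐W (1# , W-snd m 1#)) (1# , refl , refl)
    ... | x , 1≡x , W-snd≡W-snd = m+ρm-injective (begin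
      m + ρ m       ≡⟨ sym (W-snd-1 m) ⟩
      W-snd m 1#    ≡⟨ W-snd≡W-snd ⟩
      W-snd k x     ≡⟨ cong (W-snd k) (sym 1≡x) ⟩
      W-snd k 1#    ≡⟨ W-snd-1 k ⟩
      k + ρ k       ∎)

    W≉vert : ∀ {m} → ¬ _≐_ F ⟪ W m ⟫ ⟪ vert ⟫
    W≉vert {m} W≐vert = 1≢0 (Equivalence.to (W≐vert (1# , W-snd m 1#)) (1# , refl , refl))

    ψ≢0 : ∀ {t} → t ≢ 0# → ψ t ≢ 0#
    ψ≢0 t≢0 ψt≡0 = t≢0 (TwoToOne.φx≡0⇒x≡0 ψ-twoToOne ψt≡0)

    OrbitOfW : Carrier → Idx F → Set
    OrbitOfW m j = ∃ λ t → t ≢ 0# × j ≡ W (m * ψ t)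

    W∼⇔OrbitOfW : ∀ m j → _∼_ F A (W m) j ⇔ OrbitOfW m j
    W∼⇔OrbitOfW m j = mk⇔ to from
      where
      to : _∼_ F A (W m) j → OrbitOfW m j
      to (s , s≢0 , σW≐j) =
        s ⁻¹ , ⁻¹-≢0 s≢0 , W≐j⇒j≡W j (≐-trans (≐-sym (σ-image-W m s≢0)) σW≐j)
        where
        W≐j⇒j≡W : ∀ j → _≐_ F ⟪ W (m * ψ (s ⁻¹)) ⟫ ⟪ j ⟫ → j ≡ W (m * ψ (s ⁻¹))
        W≐j⇒j≡W vert W≐vert = ⊥-elim (W≉vert W≐vert)
        W≐j⇒j≡W (W k) W≐W = cong W (sym (W-injective W≐W))
      from : OrbitOfW m j → _∼_ F A (W m) j
      from (t , t≢0 , refl) = t ⁻¹ , ⁻¹-≢0 t≢0 ,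
        subst (λ c → _≐_ F (σ-image F (t ⁻¹) ⟪ W m ⟫) ⟪ W (m * ψ c) ⟫)
              (⁻¹-involutive t≢0) (σ-image-W m (⁻¹-≢0 t≢0))

    vert∼⇔≡vert : ∀ j → _∼_ F A vert j ⇔ j ≡ vert
    vert∼⇔≡vert j = mk⇔ (to j) (λ { refl → 1# , 1≢0 , σ-image-vert 1≢0 })
      where
      to : ∀ j → _∼_ F A vert j → j ≡ vert
      to vert _ = refl
      to (W k) (s , s≢0 , σvert≐W) = ⊥-elim (W≉vert (≐-trans (≐-sym σvert≐W) (σ-image-vert s≢0)))

    orbit-of-W : ∀ {C : Idx F → Set} m → (∀ j → C j ⇔ OrbitOfW m j) → IsOrbit F A C
    orbit-of-W m C⇔ = W m , λ j → ⇔.trans (C⇔ j) (⇔.sym (W∼⇔OrbitOfW m j))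

    zero⇔OrbitOfW : ∀ j → Class F zeroK j ⇔ OrbitOfW 0# j
    zero⇔OrbitOfW j = mk⇔
      (λ { refl → 1# , 1≢0 , cong W (sym (zeroˡ (ψ 1#))) })
      (λ (t , _ , j≡W) → trans j≡W (cong W (zeroˡ (ψ t))))

    square⇔OrbitOfW : ∀ j → Class F squareK j ⇔ OrbitOfW 1# j
    square⇔OrbitOfW j = mk⇔ to from
      where
      to : Class F squareK j → OrbitOfW 1# j
      to (m , refl , m≢0 , m-square) with isSquare⇒ψ-image m-square
      ... | t , ψt≡m = t , (λ t≡0 → m≢0 (trans (sym ψt≡m) (trans (cong ψ t≡0) (zeroˡ (ρ⁻¹ 0#))))) ,
                       cong W (sym (trans (*-identityˡ (ψ t)) ψt≡m))
      from : OrbitOfW 1# j → Class F squareK j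
      from (t , t≢0 , j≡W) = 1# * ψ t , j≡W , *-≢0 1≢0 (ψ≢0 t≢0) ,
                             subst (IsSquare F) (sym (*-identityˡ (ψ t))) (ψ-isSquare t)

    nonsquare⇔OrbitOfW : ∀ j → Class F nonsquareK j ⇔ OrbitOfW Square.ν j
    nonsquare⇔OrbitOfW j = mk⇔ to from
      where
      to : Class F nonsquareK j → OrbitOfW Square.ν j
      to (m , refl , m≢0 , m-nonsquare) with Square.image-or-coset m
      ... | inj₁ (y , y²≡m) = ⊥-elim (m-nonsquare (y , sym y²≡m))
      ... | inj₂ (y , νy²≡m) with isSquare⇒ψ-image (y , refl)
      ...   | t , ψt≡y² = t , t≢0 , cong W (sym (trans (cong (Square.ν *_) ψt≡y²) νy²≡m))
        where
        t≢0 : t ≢ 0#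
        t≢0 t≡0 = m≢0 (begin
          m                   ≡⟨ sym νy²≡m ⟩
          Square.ν * (y * y)  ≡⟨ cong (Square.ν *_) (sym ψt≡y²) ⟩
          Square.ν * ψ t      ≡⟨ cong (λ c → Square.ν * ψ c) t≡0 ⟩
          Square.ν * ψ 0#     ≡⟨ cong (Square.ν *_) (zeroˡ (ρ⁻¹ 0#)) ⟩
          Square.ν * 0#       ≡⟨ zeroʳ Square.ν ⟩
          0#                  ∎)
      from : OrbitOfW Square.ν j → Class F nonsquareK j
      from (t , t≢0 , j≡W) = Square.ν * ψ t , j≡W , *-≢0 Square.ν≢0 (ψ≢0 t≢0) , ν*ψt-nonsquare
        where
        ν*ψt-nonsquare : ¬ IsSquare F (Square.ν * ψ t)
        ν*ψt-nonsquare (z , νψt≡z²) with ψ-isSquare t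
        ... | y , ψt≡y² =
          Square.ν∉Image (Square.image-cancelʳ (ψ≢0 t≢0) (z , sym νψt≡z²) (y , sym ψt≡y²))

    orbits : ∀ k → IsOrbit F A (Class F k)
    orbits zeroK      = orbit-of-W 0# zero⇔OrbitOfW
    orbits vertK      = vert , λ j → ⇔.sym (vert∼⇔≡vert j)
    orbits nonsquareK = orbit-of-W Square.ν nonsquare⇔OrbitOfW
    orbits squareK    = orbit-of-W 1# square⇔OrbitOfW

  classify : ∀ i → ∃ λ k → Class F k i
  classify vert = vertK , refl
  classify (W m) with m ≟ 0# | ∃? (λ y → m ≟ y * y)
  ... | yes m≡0 | _           = zeroK , cong W m≡0
  ... | no m≢0  | yes square  = squareK , m , refl , m≢0 , square
  ... | no m≢0  | no ¬square  = nonsquareK , m , refl , m≢0 , ¬square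

lemma3p5 : (F : FiniteField) → ¬ (2 ∣ FiniteField.q F) →
    (A : Automorphism F) →
    (∃ λ x → Automorphism.ρ A x ≢ x) →
    (∀ x → x ≢ FiniteField.0# F →
      FiniteField._*_ F (Automorphism.ρ A x) (FiniteField._⁻¹ F x)
        ≢ FiniteField.-_ F (FiniteField.1# F)) →
    (∀ k → IsOrbit F A (Class F k)) × (∀ i → ∃ λ k → Class F k i)
lemma3p5 F _ A _ ρx*x⁻¹≢-1 = Orbits.orbits F A ρx*x⁻¹≢-1 , Orbits.classify F A
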